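{- The function $\textsf{LW}$ defined on pairs of words over a finite alphabet $\Sigma$ by $$\textsf{LW}(x,y)=\sum_{w\in \mathcal{M}_x \bigtriangleup \mathcal{M}_y}\frac{1}{|w|^2}$$ is a metric on $\Sigma^*$.
   Context: A word $w$ is an absent word of a word $y$ if it is not a factor (contiguous substring) of $y$; it is a minimal absent word of $y$ if moreover every proper factor of $w$ is a factor of $y$. $\mathcal{M}_y$ denotes the (finite) set of minimal absent words of $y$, and $\bigtriangleup$ denotes symmetric difference. -}

module Defs where

open import Data.Nat using (ℕ; zero; suc; _+_; _*_)
open import Data.Fin using (Fin)
open import Data.Fin.Properties using () renaming (_≟_ to _≟ᶠ_)
open import Data.List using (List; []; _∷_; _++_; map; concatMap; length; upTo; foldr; filter)
open import Data.List.Properties using (≡-dec)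
open import Data.List.Membership.Propositional using (_∈_)
open import Data.List.Membership.Propositional.Properties using (∈-map⁺; ∈-map⁻; ∈-++⁺ˡ; ∈-++⁺ʳ; ∈-++⁻)
open import Data.List.Relation.Unary.Any using (here; there)
open import Data.List.Relation.Unary.All as All using (All; all?)
open import Data.List.Relation.Binary.Prefix.Heterogeneous as Pre using (Prefix; []; _∷_)
open import Data.List.Relation.Binary.Infix.Heterogeneous as Inf using (Infix; here; there)
open import Data.List.Relation.Binary.Infix.Heterogeneous.Properties using (infix?)
open import Data.Product using (Σ; _×_; _,_; proj₁; proj₂)
open import Data.Sum using (_⊎_; inj₁; inj₂)
open import Data.Empty using (⊥; ⊥-elim)
open import Data.Integer using (+_)
open import Data.Rational using (ℚ; 0ℚ; _/_; _≤_) renaming (_+_ to _+ℚ_)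
open import Relation.Nullary using (¬_; Dec; yes; no)
open import Relation.Nullary.Decidable using (_×-dec_; ¬?; _⊎-dec_)
open import Relation.Binary.PropositionalEquality using (_≡_; _≢_; refl; sym; trans; cong)
open import Relation.Binary.Definitions using (DecidableEquality)

Word : ℕ → Set
Word k = List (Fin k)

Factor : ∀ {k} → Word k → Word k → Set
Factor u y = Infix _≡_ u y

Absent : ∀ {k} → Word k → Word k → Set
Absent w y = ¬ Factor w y

MinAbsent : ∀ {k} → Word k → Word k → Set
MinAbsent {k} w y = Absent w y × (∀ (u : Word k) → Factor u w → u ≢ w → Factor u y)

InSymDiff : ∀ {k} → Word k → Word k → Word k → Set
InSymDiff w x y = (MinAbsent w x × ¬ MinAbsent w y) ⊎ (¬ MinAbsent w x × MinAbsent w y)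

module _ {A : Set} where

  prefixes : List A → List (List A)
  prefixes []       = [] ∷ []
  prefixes (a ∷ as) = [] ∷ map (a ∷_) (prefixes as)

  infixes : List A → List (List A)
  infixes []       = [] ∷ []
  infixes (a ∷ as) = prefixes (a ∷ as) ++ infixes as

  prefixes-complete : ∀ {u w} → Prefix _≡_ u w → u ∈ prefixes w
  prefixes-complete {w = []} [] = here refl
  prefixes-complete {w = _ ∷ _} [] = here refl
  prefixes-complete (refl ∷ p) = there (∈-map⁺ _ (prefixes-complete p))

  prefixes-sound : ∀ {u} w → u ∈ prefixes w → Prefix _≡_ u w
  prefixes-sound [] (here refl) = []
  prefixes-sound (a ∷ as) (here refl) = []
  prefixes-sound (a ∷ as) (there m) with ∈-map⁻ _ m
  ... | v , v∈ , refl = refl ∷ prefixes-sound as v∈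

  infixes-complete : ∀ {u w} → Infix _≡_ u w → u ∈ infixes w
  infixes-complete {w = []} (here p) = prefixes-complete p
  infixes-complete {w = _ ∷ _} (here p) = ∈-++⁺ˡ (prefixes-complete p)
  infixes-complete {w = a ∷ as} (there i) = ∈-++⁺ʳ (prefixes (a ∷ as)) (infixes-complete i)

  infixes-sound : ∀ {u} w → u ∈ infixes w → Infix _≡_ u w
  infixes-sound [] m = here (prefixes-sound [] m)
  infixes-sound (a ∷ as) m with ∈-++⁻ (prefixes (a ∷ as)) m
  ... | inj₁ m' = here (prefixes-sound (a ∷ as) m')
  ... | inj₂ m' = there (infixes-sound as m')

factor? : ∀ {k} (u y : Word k) → Dec (Factor u y)
factor? = infix? _≟ᶠ_

minAbsent? : ∀ {k} (w y : Word k) → Dec (MinAbsent w y)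
minAbsent? {k} w y with factor? w y
... | yes f = no (λ m → proj₁ m f)
... | no ¬f with all? (λ u → ≡-dec _≟ᶠ_ u w ⊎-dec factor? u y) (infixes w)
...   | yes a = yes (¬f , λ u fu u≢w → go (All.lookup a (infixes-complete fu)) u≢w)
  where
  go : ∀ {u} → u ≡ w ⊎ Factor u y → u ≢ w → Factor u y
  go (inj₁ e) n = ⊥-elim (n e)
  go (inj₂ f) _ = f
...   | no ¬a = no (λ m → ¬a (All.tabulate (λ {u} u∈ → pick u (proj₂ m u (infixes-sound w u∈)))))
  where
  pick : ∀ u → (u ≢ w → Factor u y) → u ≡ w ⊎ Factor u y
  pick u h with ≡-dec _≟ᶠ_ u w
  ... | yes e = inj₁ e
  ... | no n = inj₂ (h n)

inSymDiff? : ∀ {k} (w x y : Word k) → Dec (InSymDiff w x y)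
inSymDiff? w x y = (minAbsent? w x ×-dec ¬? (minAbsent? w y)) ⊎-dec (¬? (minAbsent? w x) ×-dec minAbsent? w y)

wordsOfLength : ∀ k → ℕ → List (Word k)
wordsOfLength k zero    = [] ∷ []
wordsOfLength k (suc n) = concatMap (λ a → map (a ∷_) (wordsOfLength k n)) (Data.List.allFin k)

sumℚ : List ℚ → ℚ
sumℚ = foldr _+ℚ_ 0ℚ

levelSum : ∀ {k} → Word k → Word k → ℕ → ℚ
levelSum {k} x y m =
  sumℚ (map (λ _ → + 1 / (suc m * suc m)) (filter (λ w → inSymDiff? w x y) (wordsOfLength k (suc m))))

-- Every minimal absent word w of y satisfies 1 ≤ |w| ≤ |y| + 2 (the empty word
-- is a factor of every word, and w = a u b with u a factor of y), so it
-- suffices to range over word lengths 1 .. |x| + |y| + 2.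
LW : ∀ {k} → Word k → Word k → ℚ
LW x y = sumℚ (map (levelSum x y) (upTo (length x + length y + 2)))

record IsMetric {A : Set} (d : A → A → ℚ) : Set where
  field
    nonneg     : ∀ x y → 0ℚ ≤ d x y
    zero⇒eq    : ∀ x y → d x y ≡ 0ℚ → x ≡ y
    eq⇒zero    : ∀ x → d x x ≡ 0ℚ
    symmetric  : ∀ x y → d x y ≡ d y x
    triangle   : ∀ x y z → d x z ≤ d x y +ℚ d y z

module Submission where

-- Grouping the words w ∈ M_x △ M_y by length, level m of LW x y is
--   levelSum x y m = #{w ∈ M_x △ M_y : |w| = m + 1} · 1/(m + 1)²,
-- and LW x y is the sum of the levels m < |x| + |y| + 2.  Every metric axiom is
-- checked level by level:
--  * levels are nonnegative, and vanish from |x| + |y| + 2 on because a minimal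
--    absent word of y has length at most |y| + 1; hence LW x y may be computed
--    over any sufficiently long range of levels, which aligns the three sums in
--    the triangle inequality;
--  * symmetry and LW x x = 0 come from the symmetry of △ and M_x △ M_x = ∅;
--  * the triangle inequality comes from M_x △ M_z ⊆ (M_x △ M_y) ∪ (M_y △ M_z);
--  * if LW x y = 0 then M_x = M_y, as each word of M_x △ M_y has positive
--    weight; and M_x = M_y forces x = y, because every absent word contains a
--    minimal absent word, so x and y have the same factors.

open import Defs
open import Data.Nat using (ℕ; zero; suc; z≤n; s≤s) renaming (_+_ to _+ₙ_; _*_ to _*ₙ_; _≤_ to _≤ₙ_; _<_ to _<ₙ_)
import Data.Nat.Properties as ℕP
open import Data.Fin.Properties using () renaming (_≟_ to _≟ᶠ_)
open import Data.List using (List; []; _∷_; map; filter; length; applyUpTo; allFin)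
open import Data.List.Properties using (filter-none; filter-≐; ≡-dec)
open import Data.List.Membership.Propositional using (_∈_; find; lose)
open import Data.List.Membership.Propositional.Properties using (∈-map⁺; ∈-map⁻; ∈-concatMap⁺; ∈-concatMap⁻; ∈-allFin; ∈-filter⁺)
open import Data.List.Relation.Unary.Any as Any using (here; there; any?)
open import Data.List.Relation.Unary.All as All using ()
open import Data.List.Relation.Binary.Pointwise using (Pointwise-≡⇒≡; ≡⇒Pointwise-≡)
open import Data.List.Relation.Binary.Prefix.Heterogeneous using ([])
import Data.List.Relation.Binary.Prefix.Heterogeneous.Properties as PrefixP
open import Data.List.Relation.Binary.Infix.Heterogeneous using (here; there)
import Data.List.Relation.Binary.Infix.Heterogeneous.Properties as InfixP
open import Data.Integer using (+_)
open import Data.Rational using (ℚ; 0ℚ; _/_) renaming (_+_ to _+ℚ_; _≤_ to _≤ℚ_; _<_ to _<ℚ_)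
import Data.Rational.Properties as ℚP
open import Algebra.Bundles using (CommutativeMonoid)
open import Algebra.Properties.CommutativeSemigroup
  (CommutativeMonoid.commutativeSemigroup ℚP.+-0-commutativeMonoid) using (interchange)
open import Data.Product using (∃; _×_; _,_; proj₁)
open import Data.Sum using (_⊎_; inj₁; inj₂)
open import Data.Empty using (⊥-elim)
open import Function using (_∘_)
open import Relation.Nullary using (¬_; Dec; yes; no)
open import Relation.Nullary.Decidable using (¬?; _×-dec_; decidable-stable)
open import Relation.Binary.PropositionalEquality using (_≡_; _≢_; refl; sym; trans; cong; cong₂; subst; module ≡-Reasoning)

-- Sign rules for sums; 0 + 0 reduces to 0, so these are instances of the
-- monotonicity of addition.
nonneg-+ : ∀ {a b} → 0ℚ ≤ℚ a → 0ℚ ≤ℚ b → 0ℚ ≤ℚ a +ℚ b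
nonneg-+ = ℚP.+-mono-≤

pos-+ʳ : ∀ {a b} → 0ℚ ≤ℚ a → 0ℚ <ℚ b → 0ℚ <ℚ a +ℚ b
pos-+ʳ = ℚP.+-mono-≤-<

pos-+ˡ : ∀ {a b} → 0ℚ <ℚ a → 0ℚ ≤ℚ b → 0ℚ <ℚ a +ℚ b
pos-+ˡ = ℚP.+-mono-<-≤

sumBelow : (ℕ → ℚ) → ℕ → ℚ
sumBelow f zero    = 0ℚ
sumBelow f (suc n) = f 0 +ℚ sumBelow (f ∘ suc) n

sum-applyUpTo : ∀ (f : ℕ → ℚ) (g : ℕ → ℕ) n → sumℚ (map f (applyUpTo g n)) ≡ sumBelow (f ∘ g) n
sum-applyUpTo f g zero    = refl
sum-applyUpTo f g (suc n) = cong (f (g 0) +ℚ_) (sum-applyUpTo f (g ∘ suc) n)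

sumBelow-cong : ∀ {f g : ℕ → ℚ} n → (∀ m → f m ≡ g m) → sumBelow f n ≡ sumBelow g n
sumBelow-cong zero    f≡g = refl
sumBelow-cong (suc n) f≡g = cong₂ _+ℚ_ (f≡g 0) (sumBelow-cong n (f≡g ∘ suc))

sumBelow-zero : ∀ {f : ℕ → ℚ} n → (∀ m → f m ≡ 0ℚ) → sumBelow f n ≡ 0ℚ
sumBelow-zero zero    f≡0 = refl
sumBelow-zero (suc n) f≡0 = cong₂ _+ℚ_ (f≡0 0) (sumBelow-zero n (f≡0 ∘ suc))

sumBelow-extend : ∀ (f : ℕ → ℚ) {M N} → M ≤ₙ N → (∀ m → M ≤ₙ m → f m ≡ 0ℚ) →
                  sumBelow f N ≡ sumBelow f M
sumBelow-extend f {N = N} z≤n     f≡0 = sumBelow-zero N (λ m → f≡0 m z≤n)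
sumBelow-extend f         (s≤s M≤N) f≡0 =
  cong (f 0 +ℚ_) (sumBelow-extend (f ∘ suc) M≤N (λ m M≤m → f≡0 (suc m) (s≤s M≤m)))

sumBelow-nonneg : ∀ {f : ℕ → ℚ} n → (∀ m → 0ℚ ≤ℚ f m) → 0ℚ ≤ℚ sumBelow f n
sumBelow-nonneg zero    f≥0 = ℚP.≤-refl
sumBelow-nonneg (suc n) f≥0 = nonneg-+ (f≥0 0) (sumBelow-nonneg n (f≥0 ∘ suc))

sumBelow-pos : ∀ {f : ℕ → ℚ} n → (∀ m → 0ℚ ≤ℚ f m) → ∀ {m} → m <ₙ n → 0ℚ <ℚ f m →
               0ℚ <ℚ sumBelow f n
sumBelow-pos (suc n) f≥0 {zero}  _          f0>0 = pos-+ˡ f0>0 (sumBelow-nonneg n (f≥0 ∘ suc))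
sumBelow-pos (suc n) f≥0 {suc m} (s≤s m<n) fm>0 = pos-+ʳ (f≥0 0) (sumBelow-pos n (f≥0 ∘ suc) m<n fm>0)

sumBelow-subadditive : ∀ {f g h : ℕ → ℚ} n → (∀ m → f m ≤ℚ g m +ℚ h m) →
                       sumBelow f n ≤ℚ sumBelow g n +ℚ sumBelow h n
sumBelow-subadditive zero    f≤g+h = ℚP.≤-refl
sumBelow-subadditive {f} {g} {h} (suc n) f≤g+h = begin
  f 0 +ℚ sumBelow (f ∘ suc) n
    ≤⟨ ℚP.+-mono-≤ (f≤g+h 0) (sumBelow-subadditive n (f≤g+h ∘ suc)) ⟩
  (g 0 +ℚ h 0) +ℚ (sumBelow (g ∘ suc) n +ℚ sumBelow (h ∘ suc) n)
    ≡⟨ interchange (g 0) (h 0) _ _ ⟩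
  sumBelow g (suc n) +ℚ sumBelow h (suc n) ∎
  where open ℚP.≤-Reasoning

times : ℚ → ℕ → ℚ
times c zero    = 0ℚ
times c (suc n) = c +ℚ times c n

sum-const : ∀ {A : Set} (c : ℚ) (xs : List A) → sumℚ (map (λ _ → c) xs) ≡ times c (length xs)
sum-const c []       = refl
sum-const c (_ ∷ xs) = cong (c +ℚ_) (sum-const c xs)

times-+ : ∀ c a b → times c (a +ₙ b) ≡ times c a +ℚ times c b
times-+ c zero    b = sym (ℚP.+-identityˡ _)
times-+ c (suc a) b = trans (cong (c +ℚ_) (times-+ c a b)) (sym (ℚP.+-assoc c _ _))

times-nonneg : ∀ {c} n → 0ℚ ≤ℚ c → 0ℚ ≤ℚ times c n
times-nonneg zero    c≥0 = ℚP.≤-refl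
times-nonneg (suc n) c≥0 = nonneg-+ c≥0 (times-nonneg n c≥0)

times-pos : ∀ {c} n → 0ℚ <ℚ c → 0ℚ <ℚ times c (suc n)
times-pos n c>0 = pos-+ˡ c>0 (times-nonneg n (ℚP.<⇒≤ c>0))

times-mono : ∀ {c a b} → 0ℚ ≤ℚ c → a ≤ₙ b → times c a ≤ℚ times c b
times-mono {b = b} c≥0 z≤n     = times-nonneg b c≥0
times-mono {c}     c≥0 (s≤s a≤b) = ℚP.+-monoʳ-≤ c (times-mono c≥0 a≤b)

times-subadditive : ∀ {c n} a b → 0ℚ ≤ℚ c → n ≤ₙ a +ₙ b → times c n ≤ℚ times c a +ℚ times c b
times-subadditive {c} {n} a b c≥0 n≤a+b = begin
  times c n        ≤⟨ times-mono c≥0 n≤a+b ⟩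
  times c (a +ₙ b) ≡⟨ times-+ c a b ⟩
  times c a +ℚ times c b ∎
  where open ℚP.≤-Reasoning

count-subadditive : ∀ {A : Set} {P Q R : A → Set}
  (P? : ∀ a → Dec (P a)) (Q? : ∀ a → Dec (Q a)) (R? : ∀ a → Dec (R a)) →
  (∀ a → P a → Q a ⊎ R a) → ∀ xs →
  length (filter P? xs) ≤ₙ length (filter Q? xs) +ₙ length (filter R? xs)
count-subadditive P? Q? R? P⊆Q∪R []       = z≤n
count-subadditive P? Q? R? P⊆Q∪R (x ∷ xs) with IH ← count-subadditive P? Q? R? P⊆Q∪R xs
  | P? x | Q? x | R? x
... | no _  | no _  | no _  = IH
... | no _  | yes _ | no _  = ℕP.m≤n⇒m≤1+n IH
... | no _  | no _  | yes _ = ℕP.≤-trans IH (ℕP.+-monoʳ-≤ _ (ℕP.n≤1+n _))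
... | no _  | yes _ | yes _ = ℕP.m≤n⇒m≤1+n (ℕP.≤-trans IH (ℕP.+-monoʳ-≤ _ (ℕP.n≤1+n _)))
... | yes _ | yes _ | no _  = s≤s IH
... | yes _ | yes _ | yes _ = s≤s (ℕP.≤-trans IH (ℕP.+-monoʳ-≤ _ (ℕP.n≤1+n _)))
... | yes _ | no _  | yes _ = ℕP.≤-trans (s≤s IH) (ℕP.≤-reflexive (sym (ℕP.+-suc _ _)))
... | yes p | no ¬q | no ¬r with P⊆Q∪R x p
...   | inj₁ q = ⊥-elim (¬q q)
...   | inj₂ r = ⊥-elim (¬r r)

factor-refl : ∀ {k} (w : Word k) → Factor w w
factor-refl w = InfixP.fromPointwise (≡⇒Pointwise-≡ refl)

factor-trans : ∀ {k} {u v w : Word k} → Factor u v → Factor v w → Factor u w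
factor-trans = InfixP.trans trans

factor-length : ∀ {k} {u w : Word k} → Factor u w → length u ≤ₙ length w
factor-length = InfixP.length-mono

factor-antisym : ∀ {k} {u w : Word k} → Factor u w → Factor w u → u ≡ w
factor-antisym u⊑w w⊑u = Pointwise-≡⇒≡ (InfixP.antisym (λ e _ → e) u⊑w w⊑u)

proper-factor-shorter : ∀ {k} {u w : Word k} → Factor u w → u ≢ w → length u <ₙ length w
proper-factor-shorter (here u≼w) u≢w =
  ℕP.≤∧≢⇒< (PrefixP.length-mono u≼w) (λ e → u≢w (Pointwise-≡⇒≡ (PrefixP.toPointwise e u≼w)))
proper-factor-shorter (there u⊑w) _ = s≤s (factor-length u⊑w)

minAbsent-nonempty : ∀ {k} {w y : Word k} → MinAbsent w y → w ≢ []
minAbsent-nonempty (absent , _) refl = absent (here [])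

-- Writing w = a t, the proper factor t of w is a factor of y, so |w| ≤ |y| + 1.
minAbsent-length : ∀ {k} {w y : Word k} → MinAbsent w y → length w ≤ₙ suc (length y)
minAbsent-length {w = []}    w-min         = ⊥-elim (minAbsent-nonempty w-min refl)
minAbsent-length {w = a ∷ t} (_ , minimal) = s≤s (factor-length (minimal t (there (factor-refl t)) t≢at))
  where
  t≢at : t ≢ a ∷ t
  t≢at e = ℕP.<-irrefl (cong length e) (ℕP.n<1+n (length t))

shorter-absent : ∀ {k} {w y : Word k} → Absent w y → ¬ MinAbsent w y →
                 ∃ λ u → Factor u w × u ≢ w × Absent u y
shorter-absent {w = w} {y} w-absent ¬w-min
  with any? (λ u → ¬? (≡-dec _≟ᶠ_ u w) ×-dec ¬? (factor? u y)) (infixes w)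
... | yes found = let u , u∈ , u≢w , u-absent = find found in u , infixes-sound w u∈ , u≢w , u-absent
... | no none   = ⊥-elim (¬w-min (w-absent , λ u u⊑w u≢w → decidable-stable (factor? u y)
                    (λ u-absent → none (lose (infixes-complete u⊑w) (u≢w , u-absent)))))

minimal-absent-factor : ∀ {k} (y : Word k) n (w : Word k) → length w ≤ₙ n → Absent w y →
                        ∃ λ u → Factor u w × MinAbsent u y
minimal-absent-factor y zero    []      _     []-absent = ⊥-elim ([]-absent (here []))
minimal-absent-factor y (suc n) w       |w|≤n w-absent with minAbsent? w y
... | yes w-min  = w , factor-refl w , w-min
... | no ¬w-min with u , u⊑w , u≢w , u-absent ← shorter-absent w-absent ¬w-min
                with v , v⊑u , v-min ← minimal-absent-factor y n u
                       (ℕP.≤-pred (ℕP.<-≤-trans (proper-factor-shorter u⊑w u≢w) |w|≤n)) u-absent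
                = v , factor-trans v⊑u u⊑w , v-min

-- If every minimal absent word of y is one of x, every factor of x is a factor
-- of y: an absent one would contain a minimal absent word of y, absent from x.
factors-transfer : ∀ {k} {x y : Word k} → (∀ u → MinAbsent u y → MinAbsent u x) →
                   ∀ w → Factor w x → Factor w y
factors-transfer {y = y} My⊆Mx w w⊑x = decidable-stable (factor? w y) λ w-absent →
  let u , u⊑w , u-min = minimal-absent-factor y (length w) w ℕP.≤-refl w-absent
  in proj₁ (My⊆Mx u u-min) (factor-trans u⊑w w⊑x)

minAbsent-injective : ∀ {k} {x y : Word k} → (∀ u → MinAbsent u x → MinAbsent u y) →
                      (∀ u → MinAbsent u y → MinAbsent u x) → x ≡ y
minAbsent-injective {x = x} {y} Mx⊆My My⊆Mx =
  factor-antisym (factors-transfer My⊆Mx x (factor-refl x)) (factors-transfer Mx⊆My y (factor-refl y))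

symDiff-sym : ∀ {k} {w x y : Word k} → InSymDiff w x y → InSymDiff w y x
symDiff-sym (inj₁ (p , q)) = inj₂ (q , p)
symDiff-sym (inj₂ (p , q)) = inj₁ (q , p)

symDiff-irrefl : ∀ {k} {w x : Word k} → ¬ InSymDiff w x x
symDiff-irrefl (inj₁ (p , ¬p)) = ¬p p
symDiff-irrefl (inj₂ (¬p , p)) = ¬p p

symDiff-split : ∀ {k} {w x z : Word k} (y : Word k) → InSymDiff w x z → InSymDiff w x y ⊎ InSymDiff w y z
symDiff-split {w = w} y sd with minAbsent? w y | sd
... | yes my | inj₁ (mx , ¬mz) = inj₂ (inj₁ (my , ¬mz))
... | no ¬my | inj₁ (mx , ¬mz) = inj₁ (inj₁ (mx , ¬my))
... | yes my | inj₂ (¬mx , mz) = inj₁ (inj₂ (¬mx , my))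
... | no ¬my | inj₂ (¬mx , mz) = inj₂ (inj₂ (¬my , mz))

symDiff-nonempty : ∀ {k} {w x y : Word k} → InSymDiff w x y → w ≢ []
symDiff-nonempty (inj₁ (mx , _)) = minAbsent-nonempty mx
symDiff-nonempty (inj₂ (_ , my)) = minAbsent-nonempty my

symDiff-length : ∀ {k} {w x y : Word k} → InSymDiff w x y → length w ≤ₙ suc (length x +ₙ length y)
symDiff-length {x = x} {y} (inj₁ (mx , _)) =
  ℕP.≤-trans (minAbsent-length mx) (s≤s (ℕP.m≤m+n (length x) (length y)))
symDiff-length {x = x} {y} (inj₂ (_ , my)) =
  ℕP.≤-trans (minAbsent-length my) (s≤s (ℕP.m≤n+m (length y) (length x)))

no-symDiff⇒⊆ : ∀ {k} {x y : Word k} → (∀ w → ¬ InSymDiff w x y) → ∀ w → MinAbsent w x → MinAbsent w y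
no-symDiff⇒⊆ {y = y} none w mx = decidable-stable (minAbsent? w y) (λ ¬my → none w (inj₁ (mx , ¬my)))

wordsOfLength-sound : ∀ k n (w : Word k) → w ∈ wordsOfLength k n → length w ≡ n
wordsOfLength-sound k zero    w (here refl) = refl
wordsOfLength-sound k (suc n) w w∈
  with a , _ , w∈a∷ ← find (∈-concatMap⁻ (λ a → map (a ∷_) (wordsOfLength k n)) {xs = allFin k} w∈)
  with v , v∈ , refl ← ∈-map⁻ (a ∷_) w∈a∷
  = cong suc (wordsOfLength-sound k n v v∈)

wordsOfLength-complete : ∀ k (w : Word k) → w ∈ wordsOfLength k (length w)
wordsOfLength-complete k []      = here refl
wordsOfLength-complete k (a ∷ t) =
  ∈-concatMap⁺ (λ b → map (b ∷_) (wordsOfLength k (length t)))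
    (Any.map (λ { refl → ∈-map⁺ (a ∷_) (wordsOfLength-complete k t) }) (∈-allFin a))

weight : ℕ → ℚ
weight m = + 1 / (suc m *ₙ suc m)

weight-pos : ∀ m → 0ℚ <ℚ weight m
weight-pos m = ℚP.positive⁻¹ _ {{ℚP.normalize-pos 1 (suc m *ₙ suc m)}}

module _ {k : ℕ} where

  symDiff? : (x y w : Word k) → Dec (InSymDiff w x y)
  symDiff? x y w = inSymDiff? w x y

  symDiffCount : Word k → Word k → ℕ → ℕ
  symDiffCount x y m = length (filter (symDiff? x y) (wordsOfLength k (suc m)))

  levelSum-count : ∀ (x y : Word k) m → levelSum x y m ≡ times (weight m) (symDiffCount x y m)
  levelSum-count x y m = sum-const (weight m) (filter (symDiff? x y) (wordsOfLength k (suc m)))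

  levelSum-nonneg : ∀ (x y : Word k) m → 0ℚ ≤ℚ levelSum x y m
  levelSum-nonneg x y m = subst (0ℚ ≤ℚ_) (sym (levelSum-count x y m))
    (times-nonneg (symDiffCount x y m) (ℚP.<⇒≤ (weight-pos m)))

  levelSum-vanishes : ∀ (x y : Word k) m → (∀ w → length w ≡ suc m → ¬ InSymDiff w x y) →
                      levelSum x y m ≡ 0ℚ
  levelSum-vanishes x y m none = cong (sumℚ ∘ map (λ _ → weight m))
    (filter-none (symDiff? x y) (All.tabulate λ {w} w∈ → none w (wordsOfLength-sound k (suc m) w w∈)))

  levelSum-pos : ∀ {x y w : Word k} {m} → InSymDiff w x y → length w ≡ suc m → 0ℚ <ℚ levelSum x y m
  levelSum-pos {x} {y} {w} {m} sd |w|≡1+m = subst (0ℚ <ℚ_) (sym (levelSum-count x y m))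
    (nonempty (∈-filter⁺ (symDiff? x y) w∈ sd))
    where
    w∈ : w ∈ wordsOfLength k (suc m)
    w∈ = subst (λ n → w ∈ wordsOfLength k n) |w|≡1+m (wordsOfLength-complete k w)
    nonempty : ∀ {ws} → w ∈ ws → 0ℚ <ℚ times (weight m) (length ws)
    nonempty {_ ∷ ws} _ = times-pos (length ws) (weight-pos m)

  levelSum-sym : ∀ (x y : Word k) m → levelSum x y m ≡ levelSum y x m
  levelSum-sym x y m = cong (sumℚ ∘ map (λ _ → weight m))
    (filter-≐ (symDiff? x y) (symDiff? y x) (symDiff-sym , symDiff-sym) (wordsOfLength k (suc m)))

  -- Level by level, the triangle inequality is the counting form of symDiff-split.
  levelSum-triangle : ∀ (x y z : Word k) m → levelSum x z m ≤ℚ levelSum x y m +ℚ levelSum y z m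
  levelSum-triangle x y z m = begin
    levelSum x z m                            ≡⟨ levelSum-count x z m ⟩
    times (weight m) (symDiffCount x z m)     ≤⟨ times-subadditive (symDiffCount x y m) _ (ℚP.<⇒≤ (weight-pos m)) count-split ⟩
    times (weight m) (symDiffCount x y m) +ℚ times (weight m) (symDiffCount y z m)
                                              ≡⟨ sym (cong₂ _+ℚ_ (levelSum-count x y m) (levelSum-count y z m)) ⟩
    levelSum x y m +ℚ levelSum y z m          ∎
    where
    open ℚP.≤-Reasoning
    count-split : symDiffCount x z m ≤ₙ symDiffCount x y m +ₙ symDiffCount y z m
    count-split = count-subadditive (symDiff? x z) (symDiff? x y) (symDiff? y z)
                    (λ _ → symDiff-split y) (wordsOfLength k (suc m))

  bound : Word k → Word k → ℕ
  bound x y = length x +ₙ length y +ₙ 2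

  symDiff-below-bound : ∀ {x y w : Word k} {m} → InSymDiff w x y → length w ≡ suc m → m <ₙ bound x y
  symDiff-below-bound {x} {y} sd |w|≡1+m =
    ℕP.≤-<-trans (ℕP.≤-pred (subst (_≤ₙ suc (length x +ₙ length y)) |w|≡1+m (symDiff-length sd)))
                 (ℕP.m<m+n (length x +ₙ length y) (s≤s z≤n))

  levelSum-beyond : ∀ (x y : Word k) m → bound x y ≤ₙ m → levelSum x y m ≡ 0ℚ
  levelSum-beyond x y m bound≤m = levelSum-vanishes x y m
    λ w |w|≡1+m sd → ℕP.<-irrefl refl (ℕP.<-≤-trans (symDiff-below-bound sd |w|≡1+m) bound≤m)

  LW-over : ∀ (x y : Word k) {N} → bound x y ≤ₙ N → LW x y ≡ sumBelow (levelSum x y) N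
  LW-over x y bound≤N = trans (sum-applyUpTo (levelSum x y) (λ m → m) (bound x y))
    (sym (sumBelow-extend (levelSum x y) bound≤N (levelSum-beyond x y)))

  LW-pos : ∀ {x y w : Word k} → InSymDiff w x y → 0ℚ <ℚ LW x y
  LW-pos {w = []}    sd = ⊥-elim (symDiff-nonempty sd refl)
  LW-pos {x} {y} {a ∷ t} sd = subst (0ℚ <ℚ_) (sym (LW-over x y ℕP.≤-refl))
    (sumBelow-pos (bound x y) (levelSum-nonneg x y) (symDiff-below-bound sd refl) (levelSum-pos sd refl))

  LW-nonneg : ∀ (x y : Word k) → 0ℚ ≤ℚ LW x y
  LW-nonneg x y = subst (0ℚ ≤ℚ_) (sym (LW-over x y ℕP.≤-refl))
    (sumBelow-nonneg (bound x y) (levelSum-nonneg x y))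

  LW-zero⇒eq : ∀ (x y : Word k) → LW x y ≡ 0ℚ → x ≡ y
  LW-zero⇒eq x y LW≡0 = minAbsent-injective (no-symDiff⇒⊆ none) (no-symDiff⇒⊆ (λ w → none w ∘ symDiff-sym))
    where
    none : ∀ w → ¬ InSymDiff w x y
    none w sd = ℚP.<-irrefl (sym LW≡0) (LW-pos sd)

  LW-refl : ∀ (x : Word k) → LW x x ≡ 0ℚ
  LW-refl x = trans (LW-over x x ℕP.≤-refl)
    (sumBelow-zero (bound x x) λ m → levelSum-vanishes x x m λ _ _ → symDiff-irrefl)

  LW-sym : ∀ (x y : Word k) → LW x y ≡ LW y x
  LW-sym x y = begin
    LW x y                              ≡⟨ LW-over x y ℕP.≤-refl ⟩
    sumBelow (levelSum x y) (bound x y) ≡⟨ sumBelow-cong (bound x y) (levelSum-sym x y) ⟩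
    sumBelow (levelSum y x) (bound x y) ≡⟨ sym (LW-over y x bound-comm) ⟩
    LW y x                              ∎
    where
    open ≡-Reasoning
    bound-comm : bound y x ≤ₙ bound x y
    bound-comm = ℕP.≤-reflexive (cong (_+ₙ 2) (ℕP.+-comm (length y) (length x)))

  -- Sum the level-wise triangle inequality over a range N covering all three bounds.
  LW-triangle : ∀ (x y z : Word k) → LW x z ≤ℚ LW x y +ℚ LW y z
  LW-triangle x y z = begin
    LW x z                                                  ≡⟨ LW-over x z xz≤N ⟩
    sumBelow (levelSum x z) N                               ≤⟨ sumBelow-subadditive N (levelSum-triangle x y z) ⟩
    sumBelow (levelSum x y) N +ℚ sumBelow (levelSum y z) N  ≡⟨ sym (cong₂ _+ℚ_ (LW-over x y xy≤N) (LW-over y z yz≤N)) ⟩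
    LW x y +ℚ LW y z                                        ∎
    where
    open ℚP.≤-Reasoning
    N : ℕ
    N = bound x y +ₙ bound y z +ₙ bound x z
    xy≤N : bound x y ≤ₙ N
    xy≤N = ℕP.≤-trans (ℕP.m≤m+n (bound x y) (bound y z)) (ℕP.m≤m+n (bound x y +ₙ bound y z) (bound x z))
    yz≤N : bound y z ≤ₙ N
    yz≤N = ℕP.≤-trans (ℕP.m≤n+m (bound y z) (bound x y)) (ℕP.m≤m+n (bound x y +ₙ bound y z) (bound x z))
    xz≤N : bound x z ≤ₙ N
    xz≤N = ℕP.m≤n+m (bound x z) (bound x y +ₙ bound y z)

lemma2 : (k : ℕ) → IsMetric (LW {k})
lemma2 k = record
  { nonneg    = LW-nonneg
  ; zero⇒eq   = LW-zero⇒eq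
  ; eq⇒zero   = LW-refl
  ; symmetric = LW-sym
  ; triangle  = LW-triangle
  }
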